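{- Let $T=(t_i)_{i\le n}$ be a finite sequence of points of $(\mathbb{Z}^+)^2$. Then $T$ is an Erdős–Szekeres tableau (i.e. $T=T(A)$ for some sequence $A$ of $n$ distinct real numbers) if and only if for each $1\le i\le n$ we have $t_i\in W(T_{i-1})$, where $T_{i-1}=(t_1,\dots,t_{i-1})$.
   Context: For a sequence $A=(a_1,\dots,a_n)$ of distinct real numbers, let $a_i^+$ (resp. $a_i^-$) be the length of the longest increasing (resp. decreasing) subsequence of $A$ ending at $a_i$. The Erdős–Szekeres tableau (EST) of $A$ is the sequence of points $T(A)=(t_i)_{i\le n}$ with $t_i=(a_i^+,a_i^-)$. For a sequence of points $T=(t_i)_{i\le n}$, $t_i=(x_i,y_i)$, the shadow is $S(T)=\bigcup_{i\le n}\big(\{(x,y_i): 1\le x\le x_i\}\cup\{(x_i,y): 1\le y\le y_i\}\big)$ (positive integer points), and the wall is $W(T)=\big(S(T)+\{(1,0),(0,1)\}\big)\setminus S(T)$ (where $S+\{(1,0),(0,1)\}=\{s+v: s\in S, v\in\{(1,0),(0,1)\}\}$) if $|T|>0$, and $W(T)=\{(1,1)\}$ if $T$ is empty.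
   Formalization: The sequence A of distinct numbers with $T=T(A)$ takes values in ℚ instead of the real numbers. -}

module Defs where

open import Data.Nat using (ℕ; zero; suc; _+_; _≤_)
open import Data.Fin as Fin using (Fin; fromℕ; toℕ)
open import Data.Rational as ℚ using (ℚ)
open import Data.Product using (Σ; _×_; _,_; proj₁; proj₂)
open import Data.Sum using (_⊎_)
open import Data.List using (List; []; _∷_; length; lookup; take)
open import Data.List.Membership.Propositional using (_∈_)
open import Relation.Binary.PropositionalEquality using (_≡_)
open import Function.Definitions using (Injective)

Point : Set
Point = ℕ × ℕ

IncEndingAt : {n : ℕ} → (Fin n → ℚ) → Fin n → ℕ → Set
IncEndingAt {n} A i len =
  Σ ℕ λ k → len ≡ suc k ×
    (Σ (Fin (suc k) → Fin n) λ f →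
      (∀ a b → a Fin.< b → f a Fin.< f b) ×
      (∀ a b → a Fin.< b → A (f a) ℚ.< A (f b)) ×
      f (fromℕ k) ≡ i)

DecEndingAt : {n : ℕ} → (Fin n → ℚ) → Fin n → ℕ → Set
DecEndingAt {n} A i len =
  Σ ℕ λ k → len ≡ suc k ×
    (Σ (Fin (suc k) → Fin n) λ f →
      (∀ a b → a Fin.< b → f a Fin.< f b) ×
      (∀ a b → a Fin.< b → A (f b) ℚ.< A (f a)) ×
      f (fromℕ k) ≡ i)

IsLongest : (ℕ → Set) → ℕ → Set
IsLongest P m = P m × (∀ l → P l → l ≤ m)

IsESTOf : (T : List Point) → (Fin (length T) → ℚ) → Set
IsESTOf T A = ∀ i →
  IsLongest (IncEndingAt A i) (proj₁ (lookup T i)) ×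
  IsLongest (DecEndingAt A i) (proj₂ (lookup T i))

IsEST : List Point → Set
IsEST T = Σ (Fin (length T) → ℚ) λ A → Injective _≡_ _≡_ A × IsESTOf T A

InShadow : List Point → Point → Set
InShadow T p = Σ Point λ t → t ∈ T ×
  ((proj₂ p ≡ proj₂ t × 1 ≤ proj₁ p × proj₁ p ≤ proj₁ t) ⊎
   (proj₁ p ≡ proj₁ t × 1 ≤ proj₂ p × proj₂ p ≤ proj₂ t))

NotInShadow : List Point → Point → Set
NotInShadow T p = InShadow T p → Data.Empty.⊥
  where import Data.Empty

InWall : List Point → Point → Set
InWall [] p = p ≡ (1 , 1)
InWall T@(_ ∷ _) p =
  (Σ Point λ s → InShadow T s ×
     (p ≡ (proj₁ s + 1 , proj₂ s) ⊎ p ≡ (proj₁ s , proj₂ s + 1)))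
  × NotInShadow T p

Positive : Point → Set
Positive p = 1 ≤ proj₁ p × 1 ≤ proj₂ p

WallCondition : List Point → Set
WallCondition T = ∀ (i : Fin (length T)) → InWall (take (toℕ i) T) (lookup T i)

{-# OPTIONS --safe #-}
-- Write X i, Y i for the coordinates of t_i and R j i for a_j < a_i. The lengths of the longest
-- increasing subsequences ending at each a_i are characterised by the recurrence
-- X i = 1 + max {X j ∣ j < i, R j i}, and the decreasing ones by the same recurrence for the
-- converse of R. Under these recurrences t_i exceeds every earlier point in some coordinate, so it
-- avoids their shadow, and the predecessor attaining one of the maxima puts a shadow point directly
-- to the left of or below t_i. Conversely, a sequence with tableau T is built one term at a time.
-- If t_k lies one column to the right of some t_j, at height at most Y j, the new term is placed just
-- above the largest earlier term among those with Y ≥ Y k; since t_k lies outside the shadow, which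
-- is the down-set of the earlier points, both recurrences then hold at k. The case of t_k one row
-- above some t_j is the mirror image under exchanging X with Y and R with its converse.

module Submission where

open import Defs
open import Data.List using (List; _∷_; length; lookup; take)
open import Data.List.Relation.Unary.All using (All; _∷_)
open import Data.List.Relation.Unary.Any using (here; there)
open import Data.List.Membership.Propositional using (_∈_)
open import Data.Nat using (ℕ; zero; suc; _+_; _≤_; _<_; z≤n; s≤s; z<s; s<s; s<s⁻¹)
open import Data.Nat.Properties
open import Data.Nat.Induction using (<-wellFounded)
open import Induction.WellFounded using (Acc; acc)
open import Data.Fin as Fin using (Fin; fromℕ; fromℕ<; toℕ)
open import Data.Fin.Properties using (toℕ<n; toℕ-fromℕ<; fromℕ<-toℕ; toℕ-injective)
open import Data.Integer as ℤ using (+_)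
import Data.Integer.Properties as ℤ
open import Data.Rational as ℚ using (ℚ)
open import Data.Rational.Literals using (fromℤ)
import Data.Rational.Properties as ℚ
open import Data.Product using (Σ; ∃-syntax; _×_; _,_; proj₁; proj₂; swap)
open import Data.Sum as Sum using (_⊎_; inj₁; inj₂; [_,_]′)
open import Data.Empty using (⊥; ⊥-elim)
open import Function.Base using (flip; _∘_)
open import Function.Definitions using (Injective)
open import Function.Bundles using (_⇔_; mk⇔; Equivalence)
open import Relation.Nullary using (¬_; yes; no)
open import Relation.Unary using (Decidable)
open import Relation.Binary.Definitions using (Transitive; Trichotomous; Tri; tri<; tri≈; tri>)
open import Relation.Binary.PropositionalEquality

-- Paths record only consecutive S-steps; for transitive S this matches the all-pairs condition
-- of IncEndingAt.
data Path (S : ℕ → ℕ → Set) : ℕ → ℕ → ℕ → Set where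
  [_]  : ∀ e → Path S e e 1
  cons : ∀ {j s e l} → j < s → S j s → Path S s e l → Path S j e (suc l)

Chain : (ℕ → ℕ → Set) → ℕ → ℕ → Set
Chain S e l = ∃[ s ] Path S s e l

LongestChains : (ℕ → ℕ → Set) → ℕ → (ℕ → ℕ) → Set
LongestChains S n Z = ∀ i → i < n → IsLongest (Chain S i) (Z i)

-- The dynamic-programming recurrence Z i = 1 + max {Z j ∣ j < i, S j i}, where max ∅ = 0.
record RecurrenceAt (S : ℕ → ℕ → Set) (Z : ℕ → ℕ) (i : ℕ) : Set where
  constructor recurrenceAt
  field
    rises : ∀ j → j < i → S j i → Z j < Z i
    step  : Z i ≡ 1 ⊎ ∃[ j ] (j < i × S j i × suc (Z j) ≡ Z i)

open RecurrenceAt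

Recurrence : (ℕ → ℕ → Set) → ℕ → (ℕ → ℕ) → Set
Recurrence S n Z = ∀ i → i < n → RecurrenceAt S Z i

module _ {S : ℕ → ℕ → Set} where

  path-start≤end : ∀ {s e l} → Path S s e l → s ≤ e
  path-start≤end [ e ]          = ≤-refl
  path-start≤end (cons j<s _ P) = ≤-trans (<⇒≤ j<s) (path-start≤end P)

  snoc : ∀ {s j e l} → Path S s j l → j < e → S j e → Path S s e (suc l)
  snoc [ j ]             j<e Sje = cons j<e Sje [ _ ]
  snoc (cons i<s Sis P) j<e Sje = cons i<s Sis (snoc P j<e Sje)

  unsnoc : ∀ {s e l} → Path S s e l →
           (s ≡ e × l ≡ 1) ⊎ ∃[ j ] ∃[ l′ ] (l ≡ suc l′ × j < e × S j e × Path S s j l′)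
  unsnoc [ e ] = inj₁ (refl , refl)
  unsnoc (cons i<s Sis P) with unsnoc P
  ... | inj₁ (refl , refl)                   = inj₂ (_ , 1 , refl , i<s , Sis , [ _ ])
  ... | inj₂ (j , l′ , refl , j<e , Sje , P′) = inj₂ (j , suc l′ , refl , j<e , Sje , cons i<s Sis P′)

  recurrenceAt-zero : ∀ {Z} → RecurrenceAt S Z 0 → Z 0 ≡ 1
  recurrenceAt-zero (recurrenceAt _ (inj₁ Z0≡1))       = Z0≡1
  recurrenceAt-zero (recurrenceAt _ (inj₂ (_ , () , _)))

  recurrenceAt⇒positive : ∀ {Z i} → RecurrenceAt S Z i → 1 ≤ Z i
  recurrenceAt⇒positive (recurrenceAt _ (inj₁ Zi≡1))                = ≤-reflexive (sym Zi≡1)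
  recurrenceAt⇒positive (recurrenceAt _ (inj₂ (_ , _ , _ , sZj≡Zi))) =
    ≤-trans (s≤s z≤n) (≤-reflexive sZj≡Zi)

  longest⇒recurrence : ∀ {n Z} → LongestChains S n Z → Recurrence S n Z
  longest⇒recurrence {n} {Z} longest i i<n = recurrenceAt rises′ step′
    where
    rises′ : ∀ j → j < i → S j i → Z j < Z i
    rises′ j j<i Sji with proj₁ (longest j (<-trans j<i i<n))
    ... | s , P = proj₂ (longest i i<n) (suc (Z j)) (s , snoc P j<i Sji)

    step′ : Z i ≡ 1 ⊎ ∃[ j ] (j < i × S j i × suc (Z j) ≡ Z i)
    step′ with proj₁ (longest i i<n)
    ... | s , P with unsnoc P
    ... | inj₁ (_ , Zi≡1) = inj₁ Zi≡1
    ... | inj₂ (j , l′ , Zi≡1+l′ , j<i , Sji , P′) =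
      inj₂ (j , j<i , Sji , ≤-antisym (rises′ j j<i Sji)
        (≤-trans (≤-reflexive Zi≡1+l′) (s≤s (proj₂ (longest j (<-trans j<i i<n)) l′ (s , P′)))))

  recurrence⇒longest : ∀ {n Z} → Recurrence S n Z → LongestChains S n Z
  recurrence⇒longest {n} {Z} rec i i<n = chain (<-wellFounded i) i<n , bound
    where
    chain : ∀ {i} → Acc _<_ i → i < n → Chain S i (Z i)
    chain {i} (acc smaller) i<n with step (rec i i<n)
    ... | inj₁ Zi≡1 = i , subst (Path S i i) (sym Zi≡1) [ i ]
    ... | inj₂ (j , j<i , Sji , sZj≡Zi) with chain (smaller j<i) (<-trans j<i i<n)
    ...   | s , P = s , subst (Path S s i) sZj≡Zi (snoc P j<i Sji)

    climb : ∀ {s e l} → Path S s e l → e < n → Z s + l ≤ suc (Z e)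
    climb [ e ] _ = ≤-reflexive (+-comm (Z e) 1)
    climb {j} {e} {suc l} (cons {s = s} j<s Sjs P) e<n = begin
      Z j + suc l  ≡⟨ +-suc (Z j) l ⟩
      suc (Z j + l) ≤⟨ +-monoˡ-≤ l (rises (rec s s<n) j j<s Sjs) ⟩
      Z s + l      ≤⟨ climb P e<n ⟩
      suc (Z e)    ∎
      where
      open ≤-Reasoning
      s<n = ≤-<-trans (path-start≤end P) e<n

    bound : ∀ l → Chain S i l → l ≤ Z i
    bound l (s , P) = +-cancelˡ-≤ 1 l (Z i) (begin
      1 + l   ≤⟨ +-monoˡ-≤ l (recurrenceAt⇒positive (rec s s<n)) ⟩
      Z s + l ≤⟨ climb P i<n ⟩
      1 + Z i ∎)
      where
      open ≤-Reasoning
      s<n = ≤-<-trans (path-start≤end P) i<n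

  recurrence-descent : Transitive S → ∀ {n Z d m} → Recurrence S n Z → d < n → 1 ≤ m → m < Z d →
                       ∃[ e ] (e < d × S e d × Z e ≡ m)
  recurrence-descent S-trans {n} {Z} rec = descend (<-wellFounded _)
    where
    descend : ∀ {d m} → Acc _<_ d → d < n → 1 ≤ m → m < Z d → ∃[ e ] (e < d × S e d × Z e ≡ m)
    descend {d} {m} (acc smaller) d<n 1≤m m<Zd with step (rec d d<n)
    ... | inj₁ Zd≡1 = ⊥-elim (<⇒≱ m<Zd (≤-trans (≤-reflexive Zd≡1) 1≤m))
    ... | inj₂ (j , j<d , Sjd , sZj≡Zd) with m≤n⇒m<n∨m≡n (m<1+n⇒m≤n (subst (m <_) (sym sZj≡Zd) m<Zd))
    ...   | inj₂ m≡Zj = j , j<d , Sjd , sym m≡Zj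
    ...   | inj₁ m<Zj with descend (smaller j<d) (<-trans j<d d<n) 1≤m m<Zj
    ...     | e , e<j , Sej , Ze≡m = e , <-trans e<j j<d , S-trans Sej Sjd , Ze≡m

module _ {S S′ : ℕ → ℕ → Set} {Z : ℕ → ℕ} where

  recurrenceAt-resp : ∀ {i} → (∀ {j} → j < i → S′ j i ⇔ S j i) →
                      RecurrenceAt S Z i → RecurrenceAt S′ Z i
  recurrenceAt-resp S′⇔S (recurrenceAt rises step) = recurrenceAt
    (λ j j<i S′ji → rises j j<i (Equivalence.to (S′⇔S j<i) S′ji))
    (Sum.map₂ (λ (j , j<i , Sji , sZj≡Zi) → j , j<i , Equivalence.from (S′⇔S j<i) Sji , sZj≡Zi) step)

  recurrence-resp : ∀ {n} → (∀ {j i} → j < i → i < n → S′ j i ⇔ S j i) →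
                    Recurrence S n Z → Recurrence S′ n Z
  recurrence-resp S′⇔S rec i i<n = recurrenceAt-resp (λ j<i → S′⇔S j<i i<n) (rec i i<n)

recurrence-extend : ∀ {S k Z} → Recurrence S k Z → RecurrenceAt S Z k → Recurrence S (suc k) Z
recurrence-extend rec recₖ i i<1+k with m<1+n⇒m<n∨m≡n i<1+k
... | inj₁ i<k  = rec i i<k
... | inj₂ refl = recₖ

-- IncEndingAt A and DecEndingAt A are the instances Q u w = A u < A w and Q u w = A w < A u.
ChainEndingAt : {n : ℕ} → (Fin n → Fin n → Set) → Fin n → ℕ → Set
ChainEndingAt {n} Q i len =
  Σ ℕ λ k → len ≡ suc k ×
    (Σ (Fin (suc k) → Fin n) λ f →
      (∀ a b → a Fin.< b → f a Fin.< f b) ×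
      (∀ a b → a Fin.< b → Q (f a) (f b)) ×
      f (fromℕ k) ≡ i)

module FinChains {V : Set} (P : V → V → Set) (P-trans : Transitive P)
                 {n : ℕ} (A : Fin n → V) (a : ℕ → V) (a-toℕ : ∀ u → a (toℕ u) ≡ A u) where

  Q : Fin n → Fin n → Set
  Q u w = P (A u) (A w)

  S : ℕ → ℕ → Set
  S j i = P (a j) (a i)

  Increasing Related : ∀ {k} → (Fin k → Fin n) → Set
  Increasing f = ∀ x y → x Fin.< y → f x Fin.< f y
  Related    f = ∀ x y → x Fin.< y → Q (f x) (f y)

  toPath : ∀ k (f : Fin (suc k) → Fin n) → Increasing f → Related f →
           Path S (toℕ (f Fin.zero)) (toℕ (f (fromℕ k))) (suc k)
  toPath zero    f _   _   = [ _ ]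
  toPath (suc k) f inc rel =
    cons (inc Fin.zero (Fin.suc Fin.zero) z<s)
         (subst₂ P (sym (a-toℕ _)) (sym (a-toℕ _)) (rel Fin.zero (Fin.suc Fin.zero) z<s))
         (toPath k (f ∘ Fin.suc) (λ x y → inc _ _ ∘ s<s) (λ x y → rel _ _ ∘ s<s))

  fromPath : ∀ {s e l} → Path S s e l → (e<n : e < n) →
    ∃[ k ] (l ≡ suc k × Σ (Fin (suc k) → Fin n) λ f →
      Increasing f × Related f × f (fromℕ k) ≡ fromℕ< e<n × toℕ (f Fin.zero) ≡ s)
  fromPath [ e ] e<n =
    0 , refl , (λ _ → fromℕ< e<n) , (λ { Fin.zero Fin.zero () }) , (λ { Fin.zero Fin.zero () }) ,
    refl , toℕ-fromℕ< e<n
  fromPath {j} (cons {s = s} j<s Sjs P′) e<n with fromPath P′ e<n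
  ... | k , refl , f , inc , rel , f-end , f-start = suc k , refl , g , g-inc , g-rel , f-end , toℕ-fromℕ< j<n
    where
    j<n : j < n
    j<n = <-≤-trans j<s (≤-trans (path-start≤end P′) (<⇒≤ e<n))

    g : Fin (suc (suc k)) → Fin n
    g Fin.zero    = fromℕ< j<n
    g (Fin.suc x) = f x

    start≤ : ∀ y → toℕ (f Fin.zero) ≤ toℕ (f y)
    start≤ Fin.zero    = ≤-refl
    start≤ (Fin.suc y) = <⇒≤ (inc Fin.zero (Fin.suc y) z<s)

    g-inc : Increasing g
    g-inc Fin.zero    (Fin.suc y) _ =
      subst (_< toℕ (f y)) (sym (toℕ-fromℕ< j<n))
            (<-≤-trans j<s (subst (_≤ toℕ (f y)) f-start (start≤ y)))
    g-inc (Fin.suc x) (Fin.suc y) x<y = inc x y (s<s⁻¹ x<y)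

    first : Q (g Fin.zero) (f Fin.zero)
    first = subst₂ P (trans (cong a (sym (toℕ-fromℕ< j<n))) (a-toℕ _))
                     (trans (cong a (sym f-start)) (a-toℕ _)) Sjs

    g-rel : Related g
    g-rel Fin.zero    (Fin.suc Fin.zero)     _   = first
    g-rel Fin.zero    (Fin.suc (Fin.suc y)) _   = P-trans first (rel Fin.zero (Fin.suc y) z<s)
    g-rel (Fin.suc x) (Fin.suc y)           x<y = rel x y (s<s⁻¹ x<y)

  toChain : ∀ {i len} → ChainEndingAt Q i len → Chain S (toℕ i) len
  toChain (k , refl , f , inc , rel , refl) = _ , toPath k f inc rel

  fromChain : ∀ {i len} → Chain S (toℕ i) len → ChainEndingAt Q i len
  fromChain {i} (_ , P′) with fromPath P′ (toℕ<n i)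
  ... | k , len≡ , f , inc , rel , f-end , _ = k , len≡ , f , inc , rel , trans f-end (fromℕ<-toℕ i (toℕ<n i))

  longest-toℕ : ∀ {i m} → IsLongest (ChainEndingAt Q i) m → IsLongest (Chain S (toℕ i)) m
  longest-toℕ (c , maximal) = toChain c , λ l → maximal l ∘ fromChain

  longest-fromℕ : ∀ {i m} → IsLongest (Chain S (toℕ i)) m → IsLongest (ChainEndingAt Q i) m
  longest-fromℕ (c , maximal) = fromChain c , λ l → maximal l ∘ toChain

-- Shadows and walls

Hook : Point → Point → Set
Hook t p = (proj₂ p ≡ proj₂ t × 1 ≤ proj₁ p × proj₁ p ≤ proj₁ t) ⊎
           (proj₁ p ≡ proj₁ t × 1 ≤ proj₂ p × proj₂ p ≤ proj₂ t)

hook-swap : ∀ {t p} → Hook t p → Hook (swap t) (swap p)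
hook-swap = Sum.swap

hook⇒dominated : ∀ {t p} → Hook t p → proj₁ p ≤ proj₁ t × proj₂ p ≤ proj₂ t
hook⇒dominated (inj₁ (p₂≡t₂ , _ , p₁≤t₁)) = p₁≤t₁ , ≤-reflexive p₂≡t₂
hook⇒dominated (inj₂ (p₁≡t₁ , _ , p₂≤t₂)) = ≤-reflexive p₁≡t₁ , p₂≤t₂

right-of-hook : ∀ {t s p} → Hook t s → p ≡ (proj₁ s + 1 , proj₂ s) → ¬ Hook t p →
                suc (proj₁ t) ≡ proj₁ p × proj₂ p ≤ proj₂ t
right-of-hook {s = s₁ , _} (inj₂ (s₁≡t₁ , _ , s₂≤t₂)) refl _ =
  trans (cong suc (sym s₁≡t₁)) (+-comm 1 s₁) , s₂≤t₂
right-of-hook {s = s₁ , _} (inj₁ (s₂≡t₂ , 1≤s₁ , s₁≤t₁)) refl ¬hook with m≤n⇒m<n∨m≡n s₁≤t₁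
... | inj₁ s₁<t₁ =
  ⊥-elim (¬hook (inj₁ (s₂≡t₂ , m≤n+m 1 s₁ , ≤-trans (≤-reflexive (+-comm s₁ 1)) s₁<t₁)))
... | inj₂ s₁≡t₁ = trans (cong suc (sym s₁≡t₁)) (+-comm 1 s₁) , ≤-reflexive s₂≡t₂

above-hook : ∀ {t s p} → Hook t s → p ≡ (proj₁ s , proj₂ s + 1) → ¬ Hook t p →
             suc (proj₂ t) ≡ proj₂ p × proj₁ p ≤ proj₁ t
above-hook hook p≡ ¬hook = right-of-hook (hook-swap hook) (cong swap p≡) (¬hook ∘ hook-swap)

module Geometry (X Y : ℕ → ℕ) where

  pt : ℕ → Point
  pt i = X i , Y i

  Shadow : ℕ → Point → Set
  Shadow k p = ∃[ j ] (j < k × Hook (pt j) p)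

  Adjacent : ℕ → Point → Set
  Adjacent k p = ∃[ s ] (Shadow k s × (p ≡ (proj₁ s + 1 , proj₂ s) ⊎ p ≡ (proj₁ s , proj₂ s + 1)))

  WallAt : ℕ → Set
  WallAt zero    = pt 0 ≡ (1 , 1)
  WallAt (suc k) = Adjacent (suc k) (pt (suc k)) × ¬ Shadow (suc k) (pt (suc k))

  SteppedRight SteppedUp : ℕ → Set
  SteppedRight k = ∃[ j ] (j < k × suc (X j) ≡ X k × Y k ≤ Y j)
  SteppedUp    k = ∃[ j ] (j < k × suc (Y j) ≡ Y k × X k ≤ X j)

  Undominated : ℕ → Set
  Undominated k = ∀ j → j < k → X k ≤ X j → Y k ≤ Y j → ⊥

  wall⇒stepped : ∀ {k} → Adjacent k (pt k) → ¬ Shadow k (pt k) → SteppedRight k ⊎ SteppedUp k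
  wall⇒stepped (_ , (j , j<k , hook) , inj₁ right) ¬shadow =
    inj₁ (j , j<k , right-of-hook hook right (λ h → ¬shadow (j , j<k , h)))
  wall⇒stepped (_ , (j , j<k , hook) , inj₂ up) ¬shadow =
    inj₂ (j , j<k , above-hook hook up (λ h → ¬shadow (j , j<k , h)))

  stepped⇒adjacent : ∀ {k} → Positive (pt k) → SteppedRight k ⊎ SteppedUp k → Adjacent k (pt k)
  stepped⇒adjacent {k} (_ , 1≤Yk) (inj₁ (j , j<k , 1+Xj≡Xk , Yk≤Yj)) =
    (X j , Y k) , (j , j<k , inj₂ (refl , 1≤Yk , Yk≤Yj)) ,
    inj₁ (cong (_, Y k) (trans (sym 1+Xj≡Xk) (+-comm 1 (X j))))
  stepped⇒adjacent {k} (1≤Xk , _) (inj₂ (j , j<k , 1+Yj≡Yk , Xk≤Xj)) =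
    (X k , Y j) , (j , j<k , inj₁ (refl , 1≤Xk , Xk≤Xj)) ,
    inj₂ (cong (X k ,_) (trans (sym 1+Yj≡Yk) (+-comm 1 (Y j))))

-- Tableaux satisfying the recurrences

TrichotomousBelow : ℕ → (ℕ → ℕ → Set) → Set
TrichotomousBelow n R = ∀ i j → i < n → j < n → Tri (R i j) (i ≡ j) (R j i)

flip-trichotomousBelow : ∀ {n R} → TrichotomousBelow n R → TrichotomousBelow n (flip R)
flip-trichotomousBelow R-cmp i j i<n j<n with R-cmp i j i<n j<n
... | tri< Rij i≢j ¬Rji = tri> ¬Rji i≢j Rij
... | tri≈ ¬Rij i≡j ¬Rji = tri≈ ¬Rji i≡j ¬Rij
... | tri> ¬Rij i≢j Rji = tri< Rji i≢j ¬Rij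

InjectiveBelow : {V : Set} → ℕ → (ℕ → V) → Set
InjectiveBelow k a = ∀ {i j} → i < k → j < k → a i ≡ a j → i ≡ j

injective⇒trichotomousBelow : ∀ {V : Set} {_≺_ : V → V → Set} → Trichotomous _≡_ _≺_ →
  ∀ {k a} → InjectiveBelow k a → TrichotomousBelow k (λ j i → a j ≺ a i)
injective⇒trichotomousBelow compare {a = a} inj i j i<k j<k with compare (a i) (a j)
... | tri< ai≺aj ai≢aj aj⊀ai = tri< ai≺aj (ai≢aj ∘ cong a) aj⊀ai
... | tri≈ ai⊀aj ai≡aj aj⊀ai = tri≈ ai⊀aj (inj i<k j<k ai≡aj) aj⊀ai
... | tri> ai⊀aj ai≢aj aj≺ai = tri> ai⊀aj (ai≢aj ∘ cong a) aj≺ai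

module OrderedTableau (X Y : ℕ → ℕ) (R : ℕ → ℕ → Set) (R-trans : Transitive R) (n : ℕ)
                      (R-cmp : TrichotomousBelow n R)
                      (recX : Recurrence R n X) (recY : Recurrence (flip R) n Y) where
  open Geometry X Y

  R-irrefl : ∀ {i} → i < n → ¬ R i i
  R-irrefl i<n Rii with R-cmp _ _ i<n i<n
  ... | tri< _ i≢i _  = i≢i refl
  ... | tri≈ ¬Rii _ _ = ¬Rii Rii
  ... | tri> _ i≢i _  = i≢i refl

  X-rises : ∀ {j i} → j < i → i < n → R j i → X j < X i
  X-rises j<i i<n = rises (recX _ i<n) _ j<i

  Y-rises : ∀ {j i} → j < i → i < n → R i j → Y j < Y i
  Y-rises j<i i<n = rises (recY _ i<n) _ j<i

  pt-positive : ∀ {i} → i < n → Positive (pt i)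
  pt-positive i<n = recurrenceAt⇒positive (recX _ i<n) , recurrenceAt⇒positive (recY _ i<n)

  not-in-own-shadow : ∀ {i} → i < n → ¬ Shadow i (pt i)
  not-in-own-shadow {i} i<n (j , j<i , hook) with hook⇒dominated hook | R-cmp j i (<-trans j<i i<n) i<n
  ... | Xi≤Xj , _ | tri< Rji _ _ = <⇒≱ (X-rises j<i i<n Rji) Xi≤Xj
  ... | _         | tri≈ _ j≡i _ = <⇒≢ j<i j≡i
  ... | _ , Yi≤Yj | tri> _ _ Rij = <⇒≱ (Y-rises j<i i<n Rij) Yi≤Yj

  stepped : ∀ {i} → 0 < i → i < n → SteppedRight i ⊎ SteppedUp i
  stepped {i} 0<i i<n with step (recX i i<n) | step (recY i i<n)
  ... | inj₂ (j , j<i , _ , 1+Xj≡Xi) | inj₁ Yi≡1 =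
    inj₁ (j , j<i , 1+Xj≡Xi , ≤-trans (≤-reflexive Yi≡1) (proj₂ (pt-positive (<-trans j<i i<n))))
  ... | inj₁ Xi≡1 | inj₂ (g , g<i , _ , 1+Yg≡Yi) =
    inj₂ (g , g<i , 1+Yg≡Yi , ≤-trans (≤-reflexive Xi≡1) (proj₁ (pt-positive (<-trans g<i i<n))))
  ... | inj₁ Xi≡1 | inj₁ Yi≡1 with R-cmp 0 i (<-trans 0<i i<n) i<n
  ...   | tri< R0i _ _ = ⊥-elim (<⇒≱ (X-rises 0<i i<n R0i)
                           (≤-trans (≤-reflexive Xi≡1) (proj₁ (pt-positive (<-trans 0<i i<n)))))
  ...   | tri≈ _ 0≡i _ = ⊥-elim (<⇒≢ 0<i 0≡i)
  ...   | tri> _ _ Ri0 = ⊥-elim (<⇒≱ (Y-rises 0<i i<n Ri0)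
                           (≤-trans (≤-reflexive Yi≡1) (proj₂ (pt-positive (<-trans 0<i i<n)))))
  stepped {i} 0<i i<n | inj₂ (j , j<i , Rji , 1+Xj≡Xi) | inj₂ (g , g<i , Rig , 1+Yg≡Yi) with <-cmp j g
  ... | tri< j<g _ _  = inj₂ (g , g<i , 1+Yg≡Yi ,
                          subst (_≤ X g) 1+Xj≡Xi (X-rises j<g (<-trans g<i i<n) (R-trans Rji Rig)))
  ... | tri≈ _ refl _ = ⊥-elim (R-irrefl (<-trans j<i i<n) (R-trans Rji Rig))
  ... | tri> _ _ g<j  = inj₁ (j , j<i , 1+Xj≡Xi ,
                          subst (_≤ Y j) 1+Yg≡Yi (Y-rises g<j (<-trans j<i i<n) (R-trans Rji Rig)))

  wallAt : ∀ i → i < n → WallAt i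
  wallAt zero    0<n = cong₂ _,_ (recurrenceAt-zero (recX 0 0<n)) (recurrenceAt-zero (recY 0 0<n))
  wallAt (suc i) i<n = stepped⇒adjacent (pt-positive i<n) (stepped z<s i<n) , not-in-own-shadow i<n

  descentX : ∀ {d x} → d < n → 1 ≤ x → x < X d → ∃[ e ] (e < d × R e d × X e ≡ x)
  descentX = recurrence-descent R-trans recX

  descentY : ∀ {d y} → d < n → 1 ≤ y → y < Y d → ∃[ e ] (e < d × R d e × Y e ≡ y)
  descentY = recurrence-descent (λ Rba Rcb → R-trans Rcb Rba) recY

  -- The descents from d give earlier e and g with X e = x and Y g = y, whose hooks run along
  -- column x and row y; if neither reached (x , y), comparing e with g would contradict the recurrences.
  dominated⇒shadow : ∀ {d x y} → d < n → 1 ≤ x → x ≤ X d → 1 ≤ y → y ≤ Y d → Shadow n (x , y)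
  dominated⇒shadow {d} {x} {y} d<n 1≤x x≤Xd 1≤y y≤Yd with m≤n⇒m<n∨m≡n x≤Xd | m≤n⇒m<n∨m≡n y≤Yd
  ... | inj₂ x≡Xd | _         = d , d<n , inj₂ (x≡Xd , 1≤y , y≤Yd)
  ... | inj₁ _    | inj₂ y≡Yd = d , d<n , inj₁ (y≡Yd , 1≤x , x≤Xd)
  ... | inj₁ x<Xd | inj₁ y<Yd with descentX d<n 1≤x x<Xd | descentY d<n 1≤y y<Yd
  ... | e , e<d , Red , Xe≡x | g , g<d , Rdg , Yg≡y with y ≤? Y e | x ≤? X g
  ...   | yes y≤Ye | _        = e , <-trans e<d d<n , inj₂ (sym Xe≡x , 1≤y , y≤Ye)
  ...   | no _     | yes x≤Xg = g , <-trans g<d d<n , inj₁ (sym Yg≡y , 1≤x , x≤Xg)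
  ...   | no y≰Ye  | no x≰Xg with <-cmp e g
  ...     | tri< e<g _ _  = ⊥-elim (x≰Xg (<⇒≤ (subst (_< X g) Xe≡x
                              (X-rises e<g (<-trans g<d d<n) (R-trans Red Rdg)))))
  ...     | tri≈ _ refl _ = ⊥-elim (x≰Xg (≤-reflexive (sym Xe≡x)))
  ...     | tri> _ _ g<e  = ⊥-elim (y≰Ye (<⇒≤ (subst (_< Y e) Yg≡y
                              (Y-rises g<e (<-trans e<d d<n) (R-trans Red Rdg)))))

  Maximum : (ℕ → Set) → ℕ → ℕ → Set
  Maximum P k d = d < k × P d × ∀ j → j < k → P j → j ≡ d ⊎ R j d

  maximum : ∀ {P} → Decidable P → ∀ k → k ≤ n → (∀ j → j < k → ¬ P j) ⊎ ∃[ d ] Maximum P k d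
  maximum P? zero    _     = inj₁ λ _ ()
  maximum P? (suc k) 1+k≤n with maximum P? k (<⇒≤ 1+k≤n) | P? k
  ... | inj₁ none | no ¬Pk = inj₁ λ j j<1+k → [ none j , (λ { refl → ¬Pk }) ]′ (m<1+n⇒m<n∨m≡n j<1+k)
  ... | inj₁ none | yes Pk = inj₂ (k , ≤-refl , Pk , λ j j<1+k Pj →
          [ (λ j<k → ⊥-elim (none j j<k Pj)) , inj₁ ]′ (m<1+n⇒m<n∨m≡n j<1+k))
  ... | inj₂ (d , d<k , Pd , max) | no ¬Pk = inj₂ (d , m<n⇒m<1+n d<k , Pd , λ j j<1+k Pj →
          [ (λ j<k → max j j<k Pj) , (λ { refl → ⊥-elim (¬Pk Pj) }) ]′ (m<1+n⇒m<n∨m≡n j<1+k))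
  ... | inj₂ (d , d<k , Pd , max) | yes Pk with R-cmp k d 1+k≤n (<-trans d<k 1+k≤n)
  ...   | tri< Rkd _ _  = inj₂ (d , m<n⇒m<1+n d<k , Pd , λ j j<1+k Pj →
          [ (λ j<k → max j j<k Pj) , (λ { refl → inj₂ Rkd }) ]′ (m<1+n⇒m<n∨m≡n j<1+k))
  ...   | tri≈ _ k≡d _  = ⊥-elim (<⇒≢ d<k (sym k≡d))
  ...   | tri> _ _ Rdk  = inj₂ (k , ≤-refl , Pk , λ j j<1+k Pj →
          [ (λ j<k → inj₂ ([ (λ { refl → Rdk }) , (λ Rjd → R-trans Rjd Rdk) ]′ (max j j<k Pj))) , inj₁ ]′
            (m<1+n⇒m<n∨m≡n j<1+k))

  not-above : ∀ {j d} → d < n → j ≡ d ⊎ R j d → ¬ R d j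
  not-above d<n (inj₁ refl) = R-irrefl d<n
  not-above d<n (inj₂ Rjd)  = R-irrefl d<n ∘ flip R-trans Rjd

  -- The new value is placed just above the R-largest earlier value d among those with Y d ≥ Y n.
  steppedRight⇒cut : Undominated n → 1 ≤ Y n → SteppedRight n →
    ∃[ d ] (d < n × RecurrenceAt (λ j _ → ¬ R d j) X n × RecurrenceAt (λ j _ → R d j) Y n)
  steppedRight⇒cut undominated 1≤Yn (j₀ , j₀<n , 1+Xj₀≡Xn , Yn≤Yj₀)
    with maximum (λ j → Y n ≤? Y j) n ≤-refl
  ... | inj₁ none = ⊥-elim (none j₀ j₀<n Yn≤Yj₀)
  ... | inj₂ (d , d<n , Yn≤Yd , max) =
    d , d<n ,
    recurrenceAt (λ j j<n → ≰⇒> ∘ below-undominating j<n)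
                 (inj₂ (j₀ , j₀<n , not-above d<n (max j₀ j₀<n Yn≤Yj₀) , 1+Xj₀≡Xn)) ,
    recurrenceAt above-rises (height (Y n) 1≤Yn Yn≤Yd)
    where
    below-undominating : ∀ {j} → j < n → ¬ R d j → ¬ X n ≤ X j
    below-undominating {j} j<n ¬Rdj Xn≤Xj with R-cmp j d j<n d<n
    ... | tri> _ _ Rdj = ¬Rdj Rdj
    ... | tri≈ _ refl _ = undominated d d<n Xn≤Xj Yn≤Yd
    ... | tri< Rjd _ _ with <-cmp j d
    ...   | tri< j<d _ _  = undominated d d<n (≤-trans Xn≤Xj (<⇒≤ (X-rises j<d d<n Rjd))) Yn≤Yd
    ...   | tri≈ _ refl _ = R-irrefl d<n Rjd
    ...   | tri> _ _ d<j  = undominated j j<n Xn≤Xj (≤-trans Yn≤Yd (<⇒≤ (Y-rises d<j j<n Rjd)))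

    above-rises : ∀ j → j < n → R d j → Y j < Y n
    above-rises j j<n Rdj = ≰⇒> λ Yn≤Yj → not-above d<n (max j j<n Yn≤Yj) Rdj

    height : ∀ y → 1 ≤ y → y ≤ Y d → y ≡ 1 ⊎ ∃[ g ] (g < n × R d g × suc (Y g) ≡ y)
    height (suc zero)    _ _      = inj₁ refl
    height (suc (suc y)) _ 2+y≤Yd with descentY d<n (s≤s z≤n) 2+y≤Yd
    ... | g , g<d , Rdg , Yg≡1+y = inj₂ (g , <-trans g<d d<n , Rdg , cong suc Yg≡1+y)

-- Building a sequence from the wall condition

odd<odd⇔< : ∀ {a b} → suc (a + a) < suc (b + b) ⇔ a < b
odd<odd⇔< = mk⇔
  (λ p → ≰⇒> λ b≤a → <⇒≱ p (s≤s (+-mono-≤ b≤a b≤a)))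
  (λ a<b → s<s (+-mono-< a<b a<b))

odd<even⇔< : ∀ {a m} → suc (a + a) < m + m ⇔ a < m
odd<even⇔< {a} = mk⇔
  (λ p → ≰⇒> λ m≤a → <⇒≱ p (m≤n⇒m≤1+n (+-mono-≤ m≤a m≤a)))
  (λ a<m → ≤-trans (≤-reflexive (cong suc (sym (+-suc a a)))) (+-mono-≤ a<m a<m))

even<odd⇔≤ : ∀ {a m} → m + m < suc (a + a) ⇔ m ≤ a
even<odd⇔≤ = mk⇔
  (λ p → ≮⇒≥ λ a<m → <-asym p (Equivalence.from odd<even⇔< a<m))
  (λ m≤a → s≤s (+-mono-≤ m≤a m≤a))

odd≢even : ∀ a m → suc (a + a) ≢ m + m
odd≢even a m odd≡even with a <? m
... | yes a<m = <-irrefl odd≡even (Equivalence.from odd<even⇔< a<m)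
... | no  a≮m = <-irrefl (sym odd≡even) (Equivalence.from even<odd⇔≤ (≮⇒≥ a≮m))

odd-injective : ∀ {a b} → suc (a + a) ≡ suc (b + b) → a ≡ b
odd-injective odd≡odd = ≤-antisym
  (≮⇒≥ λ b<a → <-irrefl (sym odd≡odd) (Equivalence.from odd<odd⇔< b<a))
  (≮⇒≥ λ a<b → <-irrefl odd≡odd (Equivalence.from odd<odd⇔< a<b))

<1+⇔≯ : ∀ {a b} → a < suc b ⇔ (¬ b < a)
<1+⇔≯ = mk⇔ (≤⇒≯ ∘ m<1+n⇒m≤n) (s≤s ∘ ≮⇒≥)

≤⇔≯ : ∀ {a b} → a ≤ b ⇔ (¬ b < a)
≤⇔≯ = mk⇔ ≤⇒≯ ≮⇒≥

-- The old values become the odd numbers 2 v j + 1, in the same order, so that the new value 2 m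
-- lies above exactly those with v j < m.
insert : (ℕ → ℕ) → ℕ → ℕ → ℕ → ℕ
insert v k m j with j ≟ k
... | yes _ = m + m
... | no  _ = suc (v j + v j)

insert-new : ∀ v k m → insert v k m k ≡ m + m
insert-new v k m with k ≟ k
... | yes _   = refl
... | no  k≢k = ⊥-elim (k≢k refl)

insert-old : ∀ v k m {j} → j < k → insert v k m j ≡ suc (v j + v j)
insert-old v k m {j} j<k with j ≟ k
... | yes j≡k = ⊥-elim (<⇒≢ j<k j≡k)
... | no  _   = refl

Ascending : (ℕ → ℕ) → ℕ → ℕ → Set
Ascending v j i = v j < v i

module Construction (X Y : ℕ → ℕ) where
  open Geometry X Y

  Realises : ℕ → (ℕ → ℕ) → Set
  Realises k v = Recurrence (Ascending v) k X × Recurrence (flip (Ascending v)) k Y × InjectiveBelow k v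

  Cut : ℕ → (ℕ → ℕ) → ℕ → Set
  Cut k v m = RecurrenceAt (λ j _ → v j < m) X k × RecurrenceAt (λ j _ → m ≤ v j) Y k

  realises-insert : ∀ {k v m} → Realises k v → Cut k v m → Realises (suc k) (insert v k m)
  realises-insert {k} {v} {m} (recX , recY , inj) (cutX , cutY) =
    recurrence-extend (recurrence-resp (λ j<i i<k → old<old (<-trans j<i i<k) i<k) recX)
                      (recurrenceAt-resp old<new cutX) ,
    recurrence-extend (recurrence-resp (λ j<i i<k → old<old i<k (<-trans j<i i<k)) recY)
                      (recurrenceAt-resp new<old cutY) ,
    injective
    where
    w = insert v k m
    old = insert-old v k m
    new = insert-new v k m

    old<old : ∀ {j i} → j < k → i < k → w j < w i ⇔ v j < v i
    old<old j<k i<k = subst₂ (λ a b → a < b ⇔ _) (sym (old j<k)) (sym (old i<k)) odd<odd⇔<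

    old<new : ∀ {j} → j < k → w j < w k ⇔ v j < m
    old<new j<k = subst₂ (λ a b → a < b ⇔ _) (sym (old j<k)) (sym new) odd<even⇔<

    new<old : ∀ {j} → j < k → w k < w j ⇔ m ≤ v j
    new<old j<k = subst₂ (λ a b → a < b ⇔ _) (sym new) (sym (old j<k)) even<odd⇔≤

    injective : InjectiveBelow (suc k) w
    injective {i} {j} i<1+k j<1+k wi≡wj with m<1+n⇒m<n∨m≡n i<1+k | m<1+n⇒m<n∨m≡n j<1+k
    ... | inj₁ i<k  | inj₁ j<k  = inj i<k j<k (odd-injective (trans (sym (old i<k)) (trans wi≡wj (old j<k))))
    ... | inj₁ i<k  | inj₂ refl = ⊥-elim (odd≢even (v i) m (trans (sym (old i<k)) (trans wi≡wj new)))
    ... | inj₂ refl | inj₁ j<k  = ⊥-elim (odd≢even (v j) m (trans (sym (old j<k)) (trans (sym wi≡wj) new)))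
    ... | inj₂ refl | inj₂ refl = refl

  cut : ∀ {k v} → Positive (pt k) → WallAt k → Realises k v → ∃[ m ] Cut k v m
  cut {zero} _ pt₀≡ _ =
    0 , recurrenceAt (λ _ ()) (inj₁ (cong proj₁ pt₀≡)) ,
        recurrenceAt (λ _ ()) (inj₁ (cong proj₂ pt₀≡))
  cut {suc k} {v} (1≤Xn , 1≤Yn) (adjacent , ¬shadow) (recX , recY , inj) =
    [ cut-right , cut-up ]′ (wall⇒stepped adjacent ¬shadow)
    where
    module Asc = OrderedTableau X Y (Ascending v) <-trans (suc k)
                   (injective⇒trichotomousBelow <-cmp inj) recX recY
    module Desc = OrderedTableau Y X (flip (Ascending v)) (flip <-trans) (suc k)
                   (flip-trichotomousBelow (injective⇒trichotomousBelow <-cmp inj)) recY recX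

    undominated : Undominated (suc k)
    undominated j j<n Xn≤Xj Yn≤Yj = ¬shadow (Asc.dominated⇒shadow j<n 1≤Xn Xn≤Xj 1≤Yn Yn≤Yj)

    cut-right : SteppedRight (suc k) → ∃[ m ] Cut (suc k) v m
    cut-right right with Asc.steppedRight⇒cut undominated 1≤Yn right
    ... | d , _ , cutX , cutY = suc (v d) , recurrenceAt-resp (λ _ → <1+⇔≯) cutX , cutY

    cut-up : SteppedUp (suc k) → ∃[ m ] Cut (suc k) v m
    cut-up up with Desc.steppedRight⇒cut (λ j j<n Yn≤Yj Xn≤Xj → undominated j j<n Xn≤Xj Yn≤Yj) 1≤Xn up
    ... | u , _ , cutY , cutX = v u , cutX , recurrenceAt-resp (λ _ → ≤⇔≯) cutY

  realisation : ∀ n → (∀ i → i < n → Positive (pt i)) → (∀ i → i < n → WallAt i) →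
                ∃[ v ] Realises n v
  realisation zero    _        _    = (λ _ → 0) , (λ _ ()) , (λ _ ()) , λ ()
  realisation (suc k) positive wall
    with realisation k (λ i → positive i ∘ m<n⇒m<1+n) (λ i → wall i ∘ m<n⇒m<1+n)
  ... | v , realises with cut (positive k ≤-refl) (wall k ≤-refl) realises
  ...   | m , cutₘ = insert v k m , realises-insert realises cutₘ

extend : ∀ {n} {V : Set} → V → (Fin n → V) → ℕ → V
extend {zero}  d _ _       = d
extend {suc n} _ A zero    = A Fin.zero
extend {suc n} d A (suc j) = extend d (A ∘ Fin.suc) j

extend-toℕ : ∀ {n V} (d : V) (A : Fin n → V) u → extend d A (toℕ u) ≡ A u
extend-toℕ d A Fin.zero    = refl
extend-toℕ d A (Fin.suc u) = extend-toℕ d (A ∘ Fin.suc) u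

∀Fin⇒∀< : ∀ {n} {P : ℕ → Set} → (∀ (u : Fin n) → P (toℕ u)) → ∀ i → i < n → P i
∀Fin⇒∀< {P = P} Pu i i<n = subst P (toℕ-fromℕ< i<n) (Pu (fromℕ< i<n))

extend-injectiveBelow : ∀ {n V} (d : V) {A : Fin n → V} → Injective _≡_ _≡_ A →
                        InjectiveBelow n (extend d A)
extend-injectiveBelow d {A} A-injective {i} {j} i<n j<n eq = begin
  i                ≡⟨ toℕ-fromℕ< i<n ⟨
  toℕ (fromℕ< i<n) ≡⟨ cong toℕ (A-injective (trans (sym (at i<n)) (trans eq (at j<n)))) ⟩
  toℕ (fromℕ< j<n) ≡⟨ toℕ-fromℕ< j<n ⟩
  j                ∎
  where
  open ≡-Reasoning
  at : ∀ {i} (i<n : i < _) → extend d A i ≡ A (fromℕ< i<n)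
  at i<n = subst (λ i → extend d A i ≡ A (fromℕ< i<n)) (toℕ-fromℕ< i<n) (extend-toℕ d A (fromℕ< i<n))

nth : List Point → ℕ → Point
nth T = extend (0 , 0) (lookup T)

lookup≡nth : ∀ T (u : Fin (length T)) → lookup T u ≡ nth T (toℕ u)
lookup≡nth T u = sym (extend-toℕ (0 , 0) (lookup T) u)

nth∈take : ∀ T {k j} → j < k → j < length T → nth T j ∈ take k T
nth∈take (t ∷ T) {suc k} {zero}  _         _         = here refl
nth∈take (t ∷ T) {suc k} {suc j} (s<s j<k) (s<s j<n) = there (nth∈take T j<k j<n)

∈take⇒nth : ∀ T {k t} → t ∈ take k T → ∃[ j ] (j < k × nth T j ≡ t)
∈take⇒nth (t ∷ T) {suc k} (here refl) = 0 , z<s , refl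
∈take⇒nth (t ∷ T) {suc k} (there t∈) with ∈take⇒nth T t∈
... | j , j<k , nth≡t = suc j , s<s j<k , nth≡t

all-nth : ∀ {P : Point → Set} {T} → All P T → ∀ {j} → j < length T → P (nth T j)
all-nth (p ∷ _)  {zero}  _         = p
all-nth (_ ∷ ps) {suc j} (s<s j<n) = all-nth ps j<n

X[_] Y[_] : List Point → ℕ → ℕ
X[ T ] j = proj₁ (nth T j)
Y[ T ] j = proj₂ (nth T j)

module _ (T : List Point) where
  open Geometry X[ T ] Y[ T ]

  shadow⇒inShadow : ∀ {k p} → k ≤ length T → Shadow k p → InShadow (take k T) p
  shadow⇒inShadow k≤n (j , j<k , hook) = nth T j , nth∈take T j<k (<-≤-trans j<k k≤n) , hook

  inShadow⇒shadow : ∀ {k p} → InShadow (take k T) p → Shadow k p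
  inShadow⇒shadow (t , t∈ , hook) with ∈take⇒nth T t∈
  ... | j , j<k , refl = j , j<k , hook

wallAt⇒inWall : ∀ T {k} → k < length T → Geometry.WallAt X[ T ] Y[ T ] k → InWall (take k T) (nth T k)
wallAt⇒inWall T       {zero}  _   pt₀≡ = pt₀≡
wallAt⇒inWall (t ∷ T) {suc k} k<n ((s , shadow , step) , ¬shadow) =
  (s , shadow⇒inShadow (t ∷ T) (<⇒≤ k<n) shadow , step) , ¬shadow ∘ inShadow⇒shadow (t ∷ T)

inWall⇒wallAt : ∀ T {k} → k < length T → InWall (take k T) (nth T k) → Geometry.WallAt X[ T ] Y[ T ] k
inWall⇒wallAt T       {zero}  _   pt₀≡ = pt₀≡
inWall⇒wallAt (t ∷ T) {suc k} k<n ((s , shadow , step) , ¬shadow) =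
  (s , inShadow⇒shadow (t ∷ T) shadow , step) , ¬shadow ∘ shadow⇒inShadow (t ∷ T) (<⇒≤ k<n)

embed : ℕ → ℚ
embed m = fromℤ (+ m)

embed-<⇔ : ∀ {a b} → embed a ℚ.< embed b ⇔ a < b
embed-<⇔ {a} {b} = mk⇔
  (λ { (ℚ.*<* a<b) → ℤ.drop‿+<+ (subst₂ ℤ._<_ (ℤ.*-identityʳ (+ a)) (ℤ.*-identityʳ (+ b)) a<b) })
  (λ a<b → ℚ.*<* (subst₂ ℤ._<_ (sym (ℤ.*-identityʳ (+ a))) (sym (ℤ.*-identityʳ (+ b))) (ℤ.+<+ a<b)))

embed-injective : ∀ {a b} → embed a ≡ embed b → a ≡ b
embed-injective = ℤ.+-injective ∘ cong ℚ.numerator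

est⇒wallCondition : ∀ T → IsEST T → WallCondition T
est⇒wallCondition T (A , A-injective , est) u =
  subst (InWall (take (toℕ u) T)) (sym (lookup≡nth T u))
        (wallAt⇒inWall T (toℕ<n u) (Ordered.wallAt (toℕ u) (toℕ<n u)))
  where
  n = length T
  a = extend ℚ.0ℚ A
  module Inc = FinChains ℚ._<_ ℚ.<-trans A a (extend-toℕ ℚ.0ℚ A)
  module Dec = FinChains (flip ℚ._<_) (flip ℚ.<-trans) A a (extend-toℕ ℚ.0ℚ A)

  longestX : LongestChains Inc.S n X[ T ]
  longestX = ∀Fin⇒∀< λ u → subst (IsLongest (Chain Inc.S (toℕ u))) (cong proj₁ (lookup≡nth T u))
                                  (Inc.longest-toℕ (proj₁ (est u)))

  longestY : LongestChains Dec.S n Y[ T ]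
  longestY = ∀Fin⇒∀< λ u → subst (IsLongest (Chain Dec.S (toℕ u))) (cong proj₂ (lookup≡nth T u))
                                  (Dec.longest-toℕ (proj₂ (est u)))

  module Ordered = OrderedTableau X[ T ] Y[ T ] Inc.S ℚ.<-trans n
    (injective⇒trichotomousBelow ℚ.<-cmp (extend-injectiveBelow ℚ.0ℚ A-injective))
    (longest⇒recurrence longestX) (longest⇒recurrence longestY)

wallCondition⇒est : ∀ T → All Positive T → WallCondition T → IsEST T
wallCondition⇒est T positive walls
  with Construction.realisation X[ T ] Y[ T ] (length T) (λ _ → all-nth positive) (∀Fin⇒∀< λ u →
         inWall⇒wallAt T (toℕ<n u) (subst (InWall (take (toℕ u) T)) (lookup≡nth T u) (walls u)))
... | v , recX , recY , v-injective = A , A-injective , λ u →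
  subst (IsLongest (IncEndingAt A u)) (sym (cong proj₁ (lookup≡nth T u)))
        (Inc.longest-fromℕ (longestX (toℕ u) (toℕ<n u))) ,
  subst (IsLongest (DecEndingAt A u)) (sym (cong proj₂ (lookup≡nth T u)))
        (Dec.longest-fromℕ (longestY (toℕ u) (toℕ<n u)))
  where
  A : Fin (length T) → ℚ
  A = embed ∘ v ∘ toℕ

  A-injective : Injective _≡_ _≡_ A
  A-injective Au≡Aw = toℕ-injective (v-injective (toℕ<n _) (toℕ<n _) (embed-injective Au≡Aw))

  module Inc = FinChains ℚ._<_ ℚ.<-trans A (embed ∘ v) (λ _ → refl)
  module Dec = FinChains (flip ℚ._<_) (flip ℚ.<-trans) A (embed ∘ v) (λ _ → refl)

  longestX : LongestChains Inc.S (length T) X[ T ]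
  longestX = recurrence⇒longest (recurrence-resp (λ _ _ → embed-<⇔) recX)

  longestY : LongestChains Dec.S (length T) Y[ T ]
  longestY = recurrence⇒longest (recurrence-resp (λ _ _ → embed-<⇔) recY)

theorem2 : (T : List Point) → All Positive T → (IsEST T ⇔ WallCondition T)
theorem2 T positive = mk⇔ (est⇒wallCondition T) (wallCondition⇒est T positive)
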